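{- Suppose there exists a quadruple system $Q$ of order $v$ and a $\delta$-colouring of its points such that each block receives at least $3$ distinct colours. Then there exists a Kirkman triple system $K(Q)$ of order $2v+1$ that is $(\delta+1)$-colourable.
   Context: A quadruple system of order $v$ is a set of $v$ points with a set of $4$-subsets (blocks) such that each pair of points lies in exactly one block. Given a quadruple system $Q$ on points $\{q_0,\dots,q_{v-1}\}$, a $K(Q)$ is a Kirkman triple system (Steiner triple system with a partition of its triples into parallel classes) on $\{\infty\}\cup\{q_i,q_i' : 0\le i\le v-1\}$ obtained by placing, for each block $\{w,x,y,z\}$ of $Q$, the triples of a KTS$(9)$ on $\{\infty,w,x,y,z,w',x',y',z'\}$ so that the triples containing $\infty$ are $\{\infty,w,w'\},\{\infty,x,x'\},\{\infty,y,y'\},\{\infty,z,z'\}$ (the placement is not unique). A $\delta$-colouring is a map from the points to a set of $\delta$ colours; a design is $\delta$-colourable if it has a $\delta$-colouring with no monochromatic block. -}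

module Defs where

open import Data.Nat using (ℕ; suc)
open import Data.Fin using (Fin)
open import Data.List using (List; _∷_; _++_; map; concat; length)
open import Data.List.Membership.Propositional using (_∈_)
open import Data.List.Relation.Unary.All using (All)
open import Data.List.Relation.Unary.Unique.Propositional using (Unique)
open import Data.List.Relation.Binary.Permutation.Propositional using (_↭_)
open import Data.Product using (Σ; ∃; ∃-syntax; _×_)
open import Data.Unit using (⊤)
open import Relation.Nullary using (¬_)
open import Relation.Binary.PropositionalEquality using (_≡_; _≢_)

-- A block is a finite list of distinct points (a k-subset, as a list).
record IsDesign {X : Set} (k : ℕ) (P : X → Set) (B : List (List X)) : Set where
  field
    blocks-distinct : Unique B
    block-size      : ∀ {b} → b ∈ B → length b ≡ k
    block-no-repeat : ∀ {b} → b ∈ B → Unique b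
    block-points    : ∀ {b} → b ∈ B → All P b
    pair-covered    : ∀ {x y} → P x → P y → x ≢ y → ∃[ b ] (b ∈ B × x ∈ b × y ∈ b)
    pair-unique     : ∀ {x y b b′} → x ≢ y → b ∈ B → b′ ∈ B →
                      x ∈ b → y ∈ b → x ∈ b′ → y ∈ b′ → b ≡ b′

QuadrupleSystem : (v : ℕ) → List (List (Fin v)) → Set
QuadrupleSystem v B = IsDesign 4 (λ _ → ⊤) B

IsSTS : {X : Set} → (X → Set) → List (List X) → Set
IsSTS P T = IsDesign 3 P T

record ParallelClass {X : Set} (P : X → Set) (C : List (List X)) : Set where
  field
    covers  : ∀ {x} → P x → ∃[ t ] (t ∈ C × x ∈ t)
    disjoint : ∀ {x t t′} → t ∈ C → t′ ∈ C → x ∈ t → x ∈ t′ → t ≡ t′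

Resolvable : {X : Set} → (X → Set) → List (List X) → Set
Resolvable P T = ∃[ R ] (concat R ↭ T × All (ParallelClass P) R)

IsKTS : {X : Set} → (X → Set) → List (List X) → Set
IsKTS P T = IsSTS P T × Resolvable P T

-- The points {∞} ∪ {q_i, q_i′ : i < v}  (2v+1 points).
data KPt (v : ℕ) : Set where
  ∞  : KPt v
  un : Fin v → KPt v
  pr : Fin v → KPt v

Pts9 : {v : ℕ} → List (Fin v) → List (KPt v)
Pts9 b = ∞ ∷ (map un b ++ map pr b)

SameSet : {X : Set} → List X → List X → Set
SameSet {X} s t = ∀ (x : X) → (x ∈ s → x ∈ t) × (x ∈ t → x ∈ s)

-- T is (the triple set of) a K(Q) for the quadruple system with blocks B:
-- T is a KTS on all 2v+1 points, and T is (as a set of triples) the union,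
-- over the blocks b of Q, of the triples of a KTS(9) on Pts9 b whose
-- triples through ∞ are the {∞,w,w′} (w ∈ b).
record IsKQ {v : ℕ} (B : List (List (Fin v))) (T : List (List (KPt v))) : Set₁ where
  field
    kts        : IsKTS (λ _ → ⊤) T
    local      : ∀ {b} → b ∈ B → List (List (KPt v))
    local-kts  : ∀ {b} (b∈ : b ∈ B) → IsKTS (λ p → p ∈ Pts9 b) (local b∈)
    local-∞    : ∀ {b} (b∈ : b ∈ B) {w} → w ∈ b →
                 ∃[ t ] (t ∈ local b∈ × ∞ ∈ t × un w ∈ t × pr w ∈ t)
    T⊆union    : ∀ {t} → t ∈ T →
                 ∃[ b ] Σ (b ∈ B) λ b∈ → ∃[ t′ ] (t′ ∈ local b∈ × SameSet t t′)
    union⊆T    : ∀ {b} (b∈ : b ∈ B) {t′} → t′ ∈ local b∈ →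
                 ∃[ t ] (t ∈ T × SameSet t t′)

Monochromatic : {X C : Set} → (X → C) → List X → Set
Monochromatic c b = ∀ {x y} → x ∈ b → y ∈ b → c x ≡ c y

Colourable : {X : Set} → ℕ → List (List X) → Set
Colourable {X} δ T = ∃[ c ] (∀ {t} → t ∈ T → ¬ Monochromatic {X} {Fin δ} c t)

AtLeast3Colours : {X C : Set} → (X → C) → List X → Set
AtLeast3Colours c b =
  ∃[ x ] ∃[ y ] ∃[ z ] (x ∈ b × y ∈ b × z ∈ b × c x ≢ c y × c y ≢ c z × c x ≢ c z)

-- Label the KTS(9) on {∞, w, x, y, z, w′, x′, y′, z′} as the affine plane AG(2,3) so that its
-- four parallel classes correspond to the corners of the quadruple, the class of w containing
-- the spoke {∞, w, w′}.  Placing it on every block of Q, the i-th parallel class of K(Q) is the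
-- spoke of i together with, for each block through i, the two other lines of the local class of
-- i; since two points of Q lie in exactly one block these are parallel classes.  Colour q_i and
-- q_i′ with the colour of i and ∞ with a new colour.  Spokes contain ∞, and every other line of
-- AG(2,3) meets at least three of the four fibres {w, w′}, hence two of the three colours that
-- its block carries.

module Submission where

open import Defs
open import Data.Nat using (ℕ; suc; _+_; _≤_; s≤s)
import Data.Nat as ℕ
open import Data.Fin using (Fin; zero; suc; fromℕ; inject₁)
open import Data.Fin.Properties using (inject₁-injective; fromℕ≢inject₁)
import Data.Fin.Properties as Fin
open import Data.Vec using (_∷_; [])
import Data.Vec as Vec
open import Data.List using (List; []; _∷_; _++_; map; concat; concatMap; length; allFin; tabulate; filter)
open import Data.List.Properties using (map-injective; length-map; concat-map; ≡-dec; map-∘; map-++; map-tabulate)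
open import Data.List.Membership.Propositional using (_∈_; _∉_; find; lose)
open import Data.List.Membership.Propositional.Properties
  using (∈-map⁺; ∈-map⁻; ∈-allFin; ∈-tabulate⁺; ∈-tabulate⁻; ∈-concat⁺′; ∈-concat⁻′; ∈-concatMap⁺; ∈-concatMap⁻; ∈-++⁺ˡ; ∈-++⁺ʳ; ∈-++⁻; ∈-filter⁺; ∈-filter⁻)
open import Data.List.Relation.Unary.All as All using (All; []; _∷_)
import Data.List.Relation.Unary.All.Properties as All
open import Data.List.Relation.Unary.Any as Any using (Any; here; there)
import Data.List.Relation.Unary.Any.Properties as Any
open import Data.List.Relation.Unary.AllPairs as AllPairs using (AllPairs)
import Data.List.Relation.Unary.AllPairs.Properties as AllPairs
open import Data.List.Relation.Unary.Unique.Propositional using (Unique)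
import Data.List.Relation.Unary.Unique.Propositional.Properties as Unique
open import Data.List.Relation.Binary.Disjoint.Propositional using (Disjoint)
open import Data.List.Relation.Binary.Permutation.Propositional using (↭-reflexive; ↭-trans)
import Data.List.Relation.Binary.Permutation.Propositional.Properties as Perm
open import Data.Product using (Σ; ∃-syntax; ∃₂; _×_; _,_; proj₁; proj₂)
open import Data.Sum using (_⊎_; inj₁; inj₂)
open import Data.Empty using (⊥; ⊥-elim)
open import Data.Unit using (⊤; tt)
open import Function using (_∘_; id)
open import Function.Definitions using (Injective)
open import Relation.Nullary using (¬_; Dec; yes; no; map′; ¬?; _×-dec_; _⊎-dec_; toWitness)
open import Relation.Binary using (DecidableEquality)
open import Relation.Binary.PropositionalEquality using (_≡_; refl; _≢_; sym; trans; cong; cong₂; subst; module ≡-Reasoning)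

private
  variable
    X Y : Set
    m n : ℕ

Unique-concatMap⁺ : (f : X → List Y) {xs : List X} → Unique xs → (∀ {x} → x ∈ xs → Unique (f x)) →
                    (∀ {x x′ y} → x ∈ xs → x′ ∈ xs → y ∈ f x → y ∈ f x′ → x ≡ x′) →
                    Unique (concatMap f xs)
Unique-concatMap⁺ f {[]}     _               _        _         = AllPairs.[]
Unique-concatMap⁺ f {x ∷ xs} (x∉ AllPairs.∷ u) unique-f separated =
  Unique.++⁺ (unique-f (here refl))
             (Unique-concatMap⁺ f u (unique-f ∘ there) (λ x∈ x′∈ → separated (there x∈) (there x′∈)))
             disjoint
  where
  disjoint : Disjoint (f x) (concatMap f xs)
  disjoint (y∈fx , y∈rest) with find (∈-concatMap⁻ f {xs = xs} y∈rest)
  ... | x′ , x′∈xs , y∈fx′ = All.lookup x∉ x′∈xs (separated (here refl) (there x′∈xs) y∈fx y∈fx′)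

two-distinct : {t : List X} → Unique t → length t ≡ 3 → ∃₂ λ x y → x ≢ y × x ∈ t × y ∈ t
two-distinct {t = x ∷ y ∷ _} ((x≢y ∷ _) AllPairs.∷ _) _ = x , y , x≢y , here refl , there (here refl)

SameSet-refl : (t : List X) → SameSet t t
SameSet-refl t _ = id , id

-- Points of K(Q)

lift : (Fin m → Fin n) → KPt m → KPt n
lift f ∞      = ∞
lift f (un i) = un (f i)
lift f (pr i) = pr (f i)

spoke : Fin n → List (KPt n)
spoke i = ∞ ∷ un i ∷ pr i ∷ []

data Over {n} (i : Fin n) : KPt n → Set where
  over-un : Over i (un i)
  over-pr : Over i (pr i)

Meets : List (KPt n) → Fin n → Set
Meets t i = Any (Over i) t

MissesAtMostOneFibre : List (KPt n) → Set
MissesAtMostOneFibre {n} t = ∀ {i j : Fin n} → i ≢ j → Meets t i ⊎ Meets t j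

un-injective : {i j : Fin n} → un i ≡ un j → i ≡ j
un-injective refl = refl

pr-injective : {i j : Fin n} → pr i ≡ pr j → i ≡ j
pr-injective refl = refl

_≟ₚ_ : DecidableEquality (KPt n)
∞    ≟ₚ ∞    = yes refl
∞    ≟ₚ un _ = no λ ()
∞    ≟ₚ pr _ = no λ ()
un _ ≟ₚ ∞    = no λ ()
un i ≟ₚ un j = map′ (cong un) un-injective (i Fin.≟ j)
un _ ≟ₚ pr _ = no λ ()
pr _ ≟ₚ ∞    = no λ ()
pr _ ≟ₚ un _ = no λ ()
pr i ≟ₚ pr j = map′ (cong pr) pr-injective (i Fin.≟ j)

over? : (i : Fin n) (x : KPt n) → Dec (Over i x)
over? i ∞      = no λ ()
over? i (un j) = map′ (λ { refl → over-un }) (λ { over-un → refl }) (i Fin.≟ j)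
over? i (pr j) = map′ (λ { refl → over-pr }) (λ { over-pr → refl }) (i Fin.≟ j)

lift-injective : {f : Fin m → Fin n} → Injective _≡_ _≡_ f → Injective _≡_ _≡_ (lift f)
lift-injective f-inj {∞}    {∞}    _  = refl
lift-injective f-inj {un i} {un j} eq = cong un (f-inj (un-injective eq))
lift-injective f-inj {pr i} {pr j} eq = cong pr (f-inj (pr-injective eq))
lift-injective f-inj {∞}    {un _} ()
lift-injective f-inj {∞}    {pr _} ()
lift-injective f-inj {un _} {∞}    ()
lift-injective f-inj {un _} {pr _} ()
lift-injective f-inj {pr _} {∞}    ()
lift-injective f-inj {pr _} {un _} ()

lift-∞ : {f : Fin m → Fin n} (x : KPt m) → lift f x ≡ ∞ → x ≡ ∞
lift-∞ ∞ _ = refl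

∞∉-lift : {f : Fin m → Fin n} {t : List (KPt m)} → ∞ ∉ t → ∞ ∉ map (lift f) t
∞∉-lift ∞∉t ∞∈ with ∈-map⁻ _ ∞∈
... | x , x∈t , eq = ∞∉t (subst (_∈ _) (lift-∞ x (sym eq)) x∈t)

Over-lift : {f : Fin m → Fin n} {i : Fin m} {x : KPt m} → Over i x → Over (f i) (lift f x)
Over-lift over-un = over-un
Over-lift over-pr = over-pr

Over-unique : {i j : Fin n} {x : KPt n} → Over i x → Over j x → i ≡ j
Over-unique over-un over-un = refl
Over-unique over-pr over-pr = refl

Over-≢∞ : {i : Fin n} {x : KPt n} → Over i x → x ≢ ∞
Over-≢∞ over-un ()
Over-≢∞ over-pr ()

∞-or-Over : (x : KPt n) → x ≡ ∞ ⊎ ∃[ i ] Over i x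
∞-or-Over ∞      = inj₁ refl
∞-or-Over (un i) = inj₂ (i , over-un)
∞-or-Over (pr i) = inj₂ (i , over-pr)

Over⇒∈spoke : {i : Fin n} {x : KPt n} → Over i x → x ∈ spoke i
Over⇒∈spoke over-un = there (here refl)
Over⇒∈spoke over-pr = there (there (here refl))

∈spoke⇒Over : {i : Fin n} {x : KPt n} → x ∈ spoke i → x ≢ ∞ → Over i x
∈spoke⇒Over (here refl)                 x≢∞ = ⊥-elim (x≢∞ refl)
∈spoke⇒Over (there (here refl))         _   = over-un
∈spoke⇒Over (there (there (here refl))) _   = over-pr

spoke-unique : {i : Fin n} → Unique (spoke i)
spoke-unique = ((λ ()) ∷ (λ ()) ∷ []) AllPairs.∷ ((λ ()) ∷ []) AllPairs.∷ [] AllPairs.∷ AllPairs.[]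

spoke-pair-unique : {i j : Fin n} {x y : KPt n} → x ≢ y →
                    x ∈ spoke i → y ∈ spoke i → x ∈ spoke j → y ∈ spoke j → i ≡ j
spoke-pair-unique {x = x} x≢y x∈i y∈i x∈j y∈j with ∞-or-Over x
... | inj₂ (_ , ox) = Over-unique (∈spoke⇒Over x∈i (Over-≢∞ ox)) (∈spoke⇒Over x∈j (Over-≢∞ ox))
... | inj₁ refl     = Over-unique (∈spoke⇒Over y∈i (x≢y ∘ sym)) (∈spoke⇒Over y∈j (x≢y ∘ sym))

spoke-injective : {i j : Fin n} → spoke i ≡ spoke j → i ≡ j
spoke-injective refl = refl

Over⇒∈Pts9 : {b : List (Fin n)} {i : Fin n} {x : KPt n} → Over i x → i ∈ b → x ∈ Pts9 b
Over⇒∈Pts9         over-un i∈b = there (∈-++⁺ˡ (∈-map⁺ un i∈b))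
Over⇒∈Pts9 {b = b} over-pr i∈b = there (∈-++⁺ʳ (map un b) (∈-map⁺ pr i∈b))

∈Pts9⇒Over : {b : List (Fin n)} {i : Fin n} {x : KPt n} → Over i x → x ∈ Pts9 b → i ∈ b
∈Pts9⇒Over over-un (here ())
∈Pts9⇒Over over-pr (here ())
∈Pts9⇒Over {b = b} over-un (there x∈) with ∈-++⁻ (map un b) x∈
... | inj₁ x∈un with ∈-map⁻ un x∈un
...   | _ , i∈b , refl = i∈b
∈Pts9⇒Over {b = b} over-un (there x∈) | inj₂ x∈pr with ∈-map⁻ pr x∈pr
...   | _ , _ , ()
∈Pts9⇒Over {b = b} over-pr (there x∈) with ∈-++⁻ (map un b) x∈
... | inj₁ x∈un with ∈-map⁻ un x∈un
...   | _ , _ , ()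
∈Pts9⇒Over {b = b} over-pr (there x∈) | inj₂ x∈pr with ∈-map⁻ pr x∈pr
...   | _ , i∈b , refl = i∈b

∈-Pts9-allFin : (x : KPt n) → x ∈ Pts9 (allFin n)
∈-Pts9-allFin ∞      = here refl
∈-Pts9-allFin (un i) = Over⇒∈Pts9 over-un (∈-allFin i)
∈-Pts9-allFin (pr i) = Over⇒∈Pts9 over-pr (∈-allFin i)

-- Designs transported along an injection

module _ {P : X → Set} {Q : Y → Set} (e : X → Y) (e-injective : Injective _≡_ _≡_ e)
         (e-pres : ∀ {x} → P x → Q (e x)) (e-onto : ∀ {y} → Q y → ∃[ x ] (P x × e x ≡ y)) where

  private
    ∈-preimage : ∀ {s : List X} {x} → e x ∈ map e s → x ∈ s
    ∈-preimage ex∈ with ∈-map⁻ e ex∈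
    ... | x′ , x′∈s , eq = subst (_∈ _) (sym (e-injective eq)) x′∈s

  IsDesign-map : ∀ {k B} → IsDesign k P B → IsDesign k Q (map (map e) B)
  IsDesign-map {k} {B} D = record
    { blocks-distinct = Unique.map⁺ (map-injective e-injective) blocks-distinct
    ; block-size      = size
    ; block-no-repeat = no-repeat
    ; block-points    = points
    ; pair-covered    = covered
    ; pair-unique     = unique
    }
    where
    open IsDesign D
    size : ∀ {t} → t ∈ map (map e) B → length t ≡ k
    size t∈ with ∈-map⁻ (map e) t∈
    ... | s , s∈B , refl = trans (length-map e s) (block-size s∈B)
    no-repeat : ∀ {t} → t ∈ map (map e) B → Unique t
    no-repeat t∈ with ∈-map⁻ (map e) t∈
    ... | s , s∈B , refl = Unique.map⁺ e-injective (block-no-repeat s∈B)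
    points : ∀ {t} → t ∈ map (map e) B → All Q t
    points t∈ with ∈-map⁻ (map e) t∈
    ... | s , s∈B , refl = All.map⁺ (All.map e-pres (block-points s∈B))
    covered : ∀ {x y} → Q x → Q y → x ≢ y → ∃[ t ] (t ∈ map (map e) B × x ∈ t × y ∈ t)
    covered Qx Qy x≢y with e-onto Qx | e-onto Qy
    ... | x , Px , refl | y , Py , refl with pair-covered Px Py (λ x≡y → x≢y (cong e x≡y))
    ... | s , s∈B , x∈s , y∈s = map e s , ∈-map⁺ (map e) s∈B , ∈-map⁺ e x∈s , ∈-map⁺ e y∈s
    unique : ∀ {x y t t′} → x ≢ y → t ∈ map (map e) B → t′ ∈ map (map e) B →
             x ∈ t → y ∈ t → x ∈ t′ → y ∈ t′ → t ≡ t′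
    unique x≢y t∈ t′∈ x∈t y∈t x∈t′ y∈t′ with ∈-map⁻ (map e) t∈ | ∈-map⁻ (map e) t′∈
    ... | s , s∈B , refl | s′ , s′∈B , refl with ∈-map⁻ e x∈t | ∈-map⁻ e y∈t
    ... | x , x∈s , refl | y , y∈s , refl =
      cong (map e) (pair-unique (λ x≡y → x≢y (cong e x≡y)) s∈B s′∈B x∈s y∈s (∈-preimage x∈t′) (∈-preimage y∈t′))

  ParallelClass-map : ∀ {C} → ParallelClass P C → ParallelClass Q (map (map e) C)
  ParallelClass-map {C} PC = record { covers = covers′ ; disjoint = disjoint′ }
    where
    open ParallelClass PC
    covers′ : ∀ {y} → Q y → ∃[ t ] (t ∈ map (map e) C × y ∈ t)
    covers′ Qy with e-onto Qy
    ... | x , Px , refl with covers Px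
    ... | s , s∈C , x∈s = map e s , ∈-map⁺ (map e) s∈C , ∈-map⁺ e x∈s
    disjoint′ : ∀ {y t t′} → t ∈ map (map e) C → t′ ∈ map (map e) C → y ∈ t → y ∈ t′ → t ≡ t′
    disjoint′ t∈ t′∈ y∈t y∈t′ with ∈-map⁻ (map e) t∈ | ∈-map⁻ (map e) t′∈
    ... | s , s∈C , refl | s′ , s′∈C , refl with ∈-map⁻ e y∈t
    ... | x , x∈s , refl = cong (map e) (disjoint s∈C s′∈C x∈s (∈-preimage y∈t′))

  IsKTS-map : ∀ {B} → IsKTS P B → IsKTS Q (map (map e) B)
  IsKTS-map {B} (D , R , R↭B , R-classes) =
    IsDesign-map D ,
    map (map (map e)) R ,
    ↭-trans (↭-reflexive (concat-map R)) (Perm.map⁺ (map e) R↭B) ,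
    All.map⁺ (All.map ParallelClass-map R-classes)

-- Checking finite designs by computation

module FiniteCheck {X : Set} (_≟_ : DecidableEquality X) (points : List X) (∈-points : ∀ x → x ∈ points) where

  open import Data.List.Membership.DecPropositional _≟_ using (_∈?_)
  open import Data.List.Relation.Unary.Unique.DecPropositional _≟_ using () renaming (unique? to unique-points?)
  open import Data.List.Relation.Unary.Unique.DecPropositional (≡-dec _≟_) using (unique?)

  _≟ₗ_ : DecidableEquality (List X)
  _≟ₗ_ = ≡-dec _≟_

  SharesAtMostOne : List X → List X → Set
  SharesAtMostOne t t′ = All (λ x → All (λ y → x ≡ y ⊎ ¬ (x ∈ t′ × y ∈ t′)) t) t

  DesignCertificate : ℕ → List (List X) → Set
  DesignCertificate k B =
    Unique B × All (λ t → length t ≡ k) B × All Unique B ×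
    All (λ x → All (λ y → x ≡ y ⊎ Any (λ t → x ∈ t × y ∈ t) B) points) points ×
    All (λ t → All (λ t′ → t ≡ t′ ⊎ SharesAtMostOne t t′) B) B

  designCertificate? : ∀ k B → Dec (DesignCertificate k B)
  designCertificate? k B =
    unique? B ×-dec All.all? (λ t → length t ℕ.≟ k) B ×-dec All.all? unique-points? B ×-dec
    All.all? (λ x → All.all? (λ y → (x ≟ y) ⊎-dec Any.any? (λ t → (x ∈? t) ×-dec (y ∈? t)) B) points) points ×-dec
    All.all? (λ t → All.all? (λ t′ → (t ≟ₗ t′) ⊎-dec
      All.all? (λ x → All.all? (λ y → (x ≟ y) ⊎-dec ¬? ((x ∈? t′) ×-dec (y ∈? t′))) t) t) B) B

  certificate⇒IsDesign : ∀ {k B} → DesignCertificate k B → IsDesign k (λ _ → ⊤) B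
  certificate⇒IsDesign {k} {B} (distinct , sizes , no-repeats , covering , linear) = record
    { blocks-distinct = distinct
    ; block-size      = All.lookup sizes
    ; block-no-repeat = All.lookup no-repeats
    ; block-points    = λ _ → All.tabulate (λ _ → tt)
    ; pair-covered    = covered
    ; pair-unique     = unique
    }
    where
    covered : ∀ {x y} → ⊤ → ⊤ → x ≢ y → ∃[ t ] (t ∈ B × x ∈ t × y ∈ t)
    covered {x} {y} _ _ x≢y with All.lookup (All.lookup covering (∈-points x)) (∈-points y)
    ... | inj₁ x≡y = ⊥-elim (x≢y x≡y)
    ... | inj₂ some-t = find some-t
    unique : ∀ {x y t t′} → x ≢ y → t ∈ B → t′ ∈ B → x ∈ t → y ∈ t → x ∈ t′ → y ∈ t′ → t ≡ t′
    unique x≢y t∈B t′∈B x∈t y∈t x∈t′ y∈t′ with All.lookup (All.lookup linear t∈B) t′∈B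
    ... | inj₁ t≡t′ = t≡t′
    ... | inj₂ shares with All.lookup (All.lookup shares x∈t) y∈t
    ...   | inj₁ x≡y     = ⊥-elim (x≢y x≡y)
    ...   | inj₂ not-both = ⊥-elim (not-both (x∈t′ , y∈t′))

  ClassCertificate : List (List X) → Set
  ClassCertificate C =
    All (λ x → Any (x ∈_) C) points × All (λ t → All (λ t′ → t ≡ t′ ⊎ All (_∉ t′) t) C) C

  classCertificate? : ∀ C → Dec (ClassCertificate C)
  classCertificate? C =
    All.all? (λ x → Any.any? (x ∈?_) C) points ×-dec
    All.all? (λ t → All.all? (λ t′ → (t ≟ₗ t′) ⊎-dec All.all? (λ x → ¬? (x ∈? t′)) t) C) C

  certificate⇒ParallelClass : ∀ {C} → ClassCertificate C → ParallelClass (λ _ → ⊤) C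
  certificate⇒ParallelClass {C} (covering , separated) = record { covers = covers ; disjoint = disjoint }
    where
    covers : ∀ {x} → ⊤ → ∃[ t ] (t ∈ C × x ∈ t)
    covers {x} _ = find (All.lookup covering (∈-points x))
    disjoint : ∀ {x t t′} → t ∈ C → t′ ∈ C → x ∈ t → x ∈ t′ → t ≡ t′
    disjoint t∈C t′∈C x∈t x∈t′ with All.lookup (All.lookup separated t∈C) t′∈C
    ... | inj₁ t≡t′  = t≡t′
    ... | inj₂ apart = ⊥-elim (All.lookup apart x∈t x∈t′)

-- The Kirkman triple system of order 9

open import Data.Fin.Patterns using (0F; 1F; 2F; 3F)

-- The lines of AG(2,3) on KPt 4 other than the spokes; its parallel class k is the spoke of k
-- together with rest9 k.
rest9 : Fin 4 → List (List (KPt 4))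
rest9 0F = (un 1F ∷ un 2F ∷ pr 3F ∷ []) ∷ (un 3F ∷ pr 1F ∷ pr 2F ∷ []) ∷ []
rest9 1F = (un 0F ∷ un 2F ∷ un 3F ∷ []) ∷ (pr 0F ∷ pr 2F ∷ pr 3F ∷ []) ∷ []
rest9 2F = (un 1F ∷ un 3F ∷ pr 0F ∷ []) ∷ (un 0F ∷ pr 1F ∷ pr 3F ∷ []) ∷ []
rest9 3F = (un 0F ∷ un 1F ∷ pr 2F ∷ []) ∷ (un 2F ∷ pr 0F ∷ pr 1F ∷ []) ∷ []

class9 : Fin 4 → List (List (KPt 4))
class9 k = spoke k ∷ rest9 k

classes9 : List (List (List (KPt 4)))
classes9 = map class9 (allFin 4)

triples9 : List (List (KPt 4))
triples9 = concat classes9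

open FiniteCheck _≟ₚ_ (Pts9 (allFin 4)) ∈-Pts9-allFin
open import Data.List.Membership.DecPropositional (_≟ₚ_ {4}) using (_∈?_)
open import Data.List.Membership.DecPropositional _≟ₗ_ using () renaming (_∈?_ to _∈ₗ?_)
open import Data.List.Relation.Unary.Unique.DecPropositional _≟ₗ_ using (unique?)

abstract
  design9 : IsDesign 3 (λ _ → ⊤) triples9
  design9 = certificate⇒IsDesign (toWitness {a? = designCertificate? 3 triples9} tt)

  class9-parallel : ∀ k → ParallelClass (λ _ → ⊤) (class9 k)
  class9-parallel k = certificate⇒ParallelClass (toWitness {a? = Fin.all? (classCertificate? ∘ class9)} tt k)

  ∞∉rest9 : ∀ {k t} → t ∈ rest9 k → ∞ ∉ t
  ∞∉rest9 {k} = All.lookup (toWitness {a? = Fin.all? (λ k → All.all? (λ t → ¬? (∞ ∈? t)) (rest9 k))} tt k)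

  rest9-unique : ∀ k → Unique (rest9 k)
  rest9-unique = toWitness {a? = Fin.all? (λ k → unique? (rest9 k))} tt

  rest9-separated : ∀ k k′ → All (λ t → k ≡ k′ ⊎ t ∉ rest9 k′) (rest9 k)
  rest9-separated = toWitness {a? = Fin.all? λ k → Fin.all? λ k′ →
    All.all? (λ t → (k Fin.≟ k′) ⊎-dec ¬? (t ∈ₗ? rest9 k′)) (rest9 k)} tt

  rest9-meets : ∀ k → All (λ t → ∀ i j → i ≡ j ⊎ Meets t i ⊎ Meets t j) (rest9 k)
  rest9-meets = toWitness {a? = Fin.all? λ k → All.all? (λ t → Fin.all? λ i → Fin.all? λ j →
    (i Fin.≟ j) ⊎-dec Any.any? (over? i) t ⊎-dec Any.any? (over? j) t) (rest9 k)} tt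

rest9-disjoint : ∀ {k k′ t} → t ∈ rest9 k → t ∈ rest9 k′ → k ≡ k′
rest9-disjoint {k} {k′} t∈ t∈′ with All.lookup (rest9-separated k k′) t∈
... | inj₁ k≡k′ = k≡k′
... | inj₂ t∉   = ⊥-elim (t∉ t∈′)

rest9-misses-at-most-one : ∀ {k t} → t ∈ rest9 k → MissesAtMostOneFibre t
rest9-misses-at-most-one {k} t∈ {i} {j} i≢j with All.lookup (rest9-meets k) t∈ i j
... | inj₁ i≡j = ⊥-elim (i≢j i≡j)
... | inj₂ meets = meets

kts9 : IsKTS (λ _ → ⊤) triples9
kts9 = design9 , classes9 , ↭-reflexive refl , All.map⁺ {f = class9} (All.tabulate⁺ {f = id} class9-parallel)

spoke∈triples9 : ∀ k → spoke k ∈ triples9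
spoke∈triples9 k = ∈-concat⁺′ (here refl) (∈-map⁺ class9 (∈-allFin k))

rest9⊆triples9 : ∀ {k t} → t ∈ rest9 k → t ∈ triples9
rest9⊆triples9 {k} t∈ = ∈-concat⁺′ (there t∈) (∈-map⁺ class9 (∈-allFin k))

∈triples9⁻ : ∀ {t} → t ∈ triples9 → ∃[ k ] (t ≡ spoke k ⊎ t ∈ rest9 k)
∈triples9⁻ t∈ with ∈-concat⁻′ classes9 t∈
... | s , t∈s , s∈ with ∈-map⁻ class9 s∈
...   | k , _ , refl with t∈s
...     | here t≡spoke = k , inj₁ t≡spoke
...     | there t∈rest = k , inj₂ t∈rest

-- Quadruples as injective maps from Fin 4

Pts9-map : (f : Fin m → Fin n) (b : List (Fin m)) → Pts9 (map f b) ≡ map (lift f) (Pts9 b)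
Pts9-map f b = cong (∞ ∷_) (begin
  map un (map f b) ++ map pr (map f b)                   ≡⟨ cong₂ _++_ (sym (map-∘ b)) (sym (map-∘ b)) ⟩
  map (un ∘ f) b ++ map (pr ∘ f) b                       ≡⟨ cong₂ _++_ (map-∘ b) (map-∘ b) ⟩
  map (lift f) (map un b) ++ map (lift f) (map pr b)     ≡⟨ sym (map-++ (lift f) (map un b) (map pr b)) ⟩
  map (lift f) (map un b ++ map pr b)                    ∎)
  where open ≡-Reasoning

Pts9-tabulate : (f : Fin m → Fin n) → Pts9 (tabulate f) ≡ map (lift f) (Pts9 (allFin m))
Pts9-tabulate f = trans (cong Pts9 (sym (map-tabulate id f))) (Pts9-map f (allFin _))

Unique-tabulate⇒injective : {f : Fin m → X} → Unique (tabulate f) → Injective _≡_ _≡_ f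
Unique-tabulate⇒injective (_   AllPairs.∷ _)      {zero}  {zero}  _  = refl
Unique-tabulate⇒injective (f0∉ AllPairs.∷ _)      {zero}  {suc j} eq = ⊥-elim (All.tabulate⁻ f0∉ j eq)
Unique-tabulate⇒injective (f0∉ AllPairs.∷ _)      {suc i} {zero}  eq = ⊥-elim (All.tabulate⁻ f0∉ i (sym eq))
Unique-tabulate⇒injective (_   AllPairs.∷ unique) {suc i} {suc j} eq = cong suc (Unique-tabulate⇒injective unique eq)

another : Fin (2 + n) → Fin (2 + n)
another zero    = suc zero
another (suc _) = zero

another-≢ : (i : Fin (2 + n)) → another i ≢ i
another-≢ zero    ()
another-≢ (suc _) ()

-- The corners of a list of four points; other lists get the junk corners 0.
corner : List (Fin (suc n)) → Fin 4 → Fin (suc n)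
corner (w ∷ x ∷ y ∷ z ∷ []) = Vec.lookup (w ∷ x ∷ y ∷ z ∷ [])
corner _                    = λ _ → zero

tabulate-corner : (b : List (Fin (suc n))) → length b ≡ 4 → b ≡ tabulate (corner b)
tabulate-corner (_ ∷ _ ∷ _ ∷ _ ∷ [])    refl = refl
tabulate-corner []                      ()
tabulate-corner (_ ∷ [])                ()
tabulate-corner (_ ∷ _ ∷ [])            ()
tabulate-corner (_ ∷ _ ∷ _ ∷ [])        ()
tabulate-corner (_ ∷ _ ∷ _ ∷ _ ∷ _ ∷ _) ()

-- Colourings

Meets-lift : {f : Fin m → Fin n} {t : List (KPt m)} {i : Fin m} → Meets t i → Meets (map (lift f) t) (f i)
Meets-lift meets = Any.map⁺ (Any.map Over-lift meets)

extend-colouring : ∀ {δ} → (Fin n → Fin δ) → KPt n → Fin (suc δ)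
extend-colouring {δ = δ} c ∞ = fromℕ δ
extend-colouring c (un i)    = inject₁ (c i)
extend-colouring c (pr i)    = inject₁ (c i)

module _ {δ} (c : Fin n → Fin δ) where

  extend-colouring-Over : ∀ {i x} → Over i x → extend-colouring c x ≡ inject₁ (c i)
  extend-colouring-Over over-un = refl
  extend-colouring-Over over-pr = refl

  spoke-not-monochromatic : ∀ {i} → ¬ Monochromatic (extend-colouring c) (spoke i)
  spoke-not-monochromatic mono = fromℕ≢inject₁ (mono (here refl) (there (here refl)))

  monochromatic-fibres : ∀ {t i j} → Monochromatic (extend-colouring c) t → Meets t i → Meets t j → c i ≡ c j
  monochromatic-fibres mono meets-i meets-j with find meets-i | find meets-j
  ... | x , x∈t , ox | y , y∈t , oy = inject₁-injective (begin
    inject₁ (c _)           ≡⟨ sym (extend-colouring-Over ox) ⟩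
    extend-colouring c x    ≡⟨ mono x∈t y∈t ⟩
    extend-colouring c y    ≡⟨ extend-colouring-Over oy ⟩
    inject₁ (c _)           ∎)
    where open ≡-Reasoning

meets-two-colours : {g : Fin n → Y} {t : List (KPt n)} → MissesAtMostOneFibre t →
                    ∀ {a b c} → g a ≢ g b → g b ≢ g c → g a ≢ g c →
                    ∃₂ λ i j → Meets t i × Meets t j × g i ≢ g j
meets-two-colours {g = g} misses {a} {b} {c} gab gbc gac with misses (gab ∘ cong g)
... | inj₁ meets-a with misses (gbc ∘ cong g)
...   | inj₁ meets-b = a , b , meets-a , meets-b , gab
...   | inj₂ meets-c = a , c , meets-a , meets-c , gac
meets-two-colours {g = g} misses {a} {b} {c} gab gbc gac | inj₂ meets-b with misses (gac ∘ cong g)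
...   | inj₁ meets-a = a , b , meets-a , meets-b , gab
...   | inj₂ meets-c = b , c , meets-b , meets-c , gbc

-- The construction of K(Q)

module Construction {n : ℕ} (B : List (List (Fin (2 + n)))) (QS : QuadrupleSystem (2 + n) B) where

  open IsDesign QS

  Point : Set
  Point = KPt (2 + n)

  embed : List (Fin (2 + n)) → KPt 4 → Point
  embed b = lift (corner b)

  local : List (Fin (2 + n)) → List (List Point)
  local b = map (map (embed b)) triples9

  restAt : List (Fin (2 + n)) → Fin 4 → List (List Point)
  restAt b k = map (map (embed b)) (rest9 k)

  corner-at? : (b : List (Fin (2 + n))) (i : Fin (2 + n)) (k : Fin 4) → Dec (corner b k ≡ i)
  corner-at? b i k = corner b k Fin.≟ i

  classPart : List (Fin (2 + n)) → Fin (2 + n) → List (List Point)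
  classPart b i = concatMap (restAt b) (filter (corner-at? b i) (allFin 4))

  classTail : Fin (2 + n) → List (List Point)
  classTail i = concatMap (λ b → classPart b i) B

  -- Class i consists of the spoke of i and, from every block b through i, the two
  -- further lines of the local parallel class belonging to the corner i of b.
  class : Fin (2 + n) → List (List Point)
  class i = spoke i ∷ classTail i

  resolution : List (List (List Point))
  resolution = map class (allFin (2 + n))

  T : List (List Point)
  T = concat resolution

  corner-injective : ∀ {b} → b ∈ B → Injective _≡_ _≡_ (corner b)
  corner-injective {b} b∈B =
    Unique-tabulate⇒injective (subst Unique (tabulate-corner b (block-size b∈B)) (block-no-repeat b∈B))

  embed-injective : ∀ {b} → b ∈ B → Injective _≡_ _≡_ (embed b)
  embed-injective b∈B = lift-injective (corner-injective b∈B)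

  corner∈ : ∀ {b} → b ∈ B → ∀ k → corner b k ∈ b
  corner∈ {b} b∈B k = subst (corner b k ∈_) (sym (tabulate-corner b (block-size b∈B))) (∈-tabulate⁺ {f = corner b} k)

  ∈⇒corner : ∀ {b u} → b ∈ B → u ∈ b → ∃[ k ] corner b k ≡ u
  ∈⇒corner {b} {u} b∈B u∈b with ∈-tabulate⁻ (subst (u ∈_) (tabulate-corner b (block-size b∈B)) u∈b)
  ... | k , u≡ = k , sym u≡

  Pts9-block : ∀ {b} → b ∈ B → Pts9 b ≡ map (embed b) (Pts9 (allFin 4))
  Pts9-block {b} b∈B = trans (cong Pts9 (tabulate-corner b (block-size b∈B))) (Pts9-tabulate (corner b))

  embed-into : ∀ {b} → b ∈ B → ∀ {x} → ⊤ → embed b x ∈ Pts9 b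
  embed-into {b} b∈B {x} _ = subst (embed b x ∈_) (sym (Pts9-block b∈B)) (∈-map⁺ (embed b) (∈-Pts9-allFin x))

  embed-onto : ∀ {b} → b ∈ B → ∀ {y} → y ∈ Pts9 b → ∃[ x ] (⊤ × embed b x ≡ y)
  embed-onto {b} b∈B {y} y∈ with ∈-map⁻ (embed b) (subst (y ∈_) (Pts9-block b∈B) y∈)
  ... | x , _ , y≡ = x , tt , sym y≡

  local-kts : ∀ {b} → b ∈ B → IsKTS (_∈ Pts9 b) (local b)
  local-kts {b} b∈B = IsKTS-map (embed b) (embed-injective b∈B) (embed-into b∈B) (embed-onto b∈B) kts9

  local-design : ∀ {b} → b ∈ B → IsDesign 3 (_∈ Pts9 b) (local b)
  local-design b∈B = proj₁ (local-kts b∈B)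

  local-class : ∀ {b} → b ∈ B → ∀ k → ParallelClass (_∈ Pts9 b) (map (map (embed b)) (class9 k))
  local-class {b} b∈B k =
    ParallelClass-map (embed b) (embed-injective b∈B) (embed-into b∈B) (embed-onto b∈B) (class9-parallel k)

  spoke∈local : ∀ {b u} → b ∈ B → u ∈ b → spoke u ∈ local b
  spoke∈local {b} b∈B u∈b with ∈⇒corner b∈B u∈b
  ... | k , refl = ∈-map⁺ (map (embed b)) (spoke∈triples9 k)

  local-points : ∀ {b t x} → b ∈ B → t ∈ local b → x ∈ t → x ∈ Pts9 b
  local-points b∈B t∈ x∈t = All.lookup (IsDesign.block-points (local-design b∈B) t∈) x∈t

  in-some-block : ∀ i → ∃[ b ] (b ∈ B × i ∈ b)
  in-some-block i with pair-covered {i} {another i} tt tt (another-≢ i ∘ sym)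
  ... | b , b∈B , i∈b , _ = b , b∈B , i∈b

  record RestTriple (t : List Point) : Set where
    constructor rest
    field
      block   : List (Fin (2 + n))
      block∈B : block ∈ B
      index   : Fin 4
      ∈restAt : t ∈ restAt block index

    owner : Fin (2 + n)
    owner = corner block index

  open RestTriple

  ∈classPart⁻ : ∀ b {i t} → t ∈ classPart b i → ∃[ k ] (corner b k ≡ i × t ∈ restAt b k)
  ∈classPart⁻ b {i} t∈ with find (∈-concatMap⁻ (restAt b) {xs = filter (corner-at? b i) (allFin 4)} t∈)
  ... | k , k∈ , t∈restAt = k , proj₂ (∈-filter⁻ (corner-at? b i) k∈) , t∈restAt

  ∈classTail⁻ : ∀ {i t} → t ∈ classTail i → Σ (RestTriple t) λ r → owner r ≡ i
  ∈classTail⁻ {i} t∈ with find (∈-concatMap⁻ (λ b → classPart b i) {xs = B} t∈)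
  ... | b , b∈B , t∈b with ∈classPart⁻ b t∈b
  ...   | k , corner≡i , t∈restAt = rest b b∈B k t∈restAt , corner≡i

  ∈class⁻ : ∀ {i t} → t ∈ class i → t ≡ spoke i ⊎ Σ (RestTriple t) λ r → owner r ≡ i
  ∈class⁻ (here t≡spoke) = inj₁ t≡spoke
  ∈class⁻ (there t∈)     = inj₂ (∈classTail⁻ t∈)

  ∈class⁺ : ∀ {t} (r : RestTriple t) → t ∈ class (owner r)
  ∈class⁺ (rest b b∈B k t∈) = there (∈-concatMap⁺ (λ b′ → classPart b′ i) {xs = B} (lose b∈B
    (∈-concatMap⁺ (restAt b) (lose (∈-filter⁺ (corner-at? b i) (∈-allFin k) refl) t∈))))
    where i = corner b k

  ∈T⁻ : ∀ {t} → t ∈ T → ∃[ i ] t ∈ class i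
  ∈T⁻ t∈ with ∈-concat⁻′ resolution t∈
  ... | s , t∈s , s∈ with ∈-map⁻ class s∈
  ...   | i , _ , refl = i , t∈s

  ∈T⁺ : ∀ {i t} → t ∈ class i → t ∈ T
  ∈T⁺ {i} t∈ = ∈-concat⁺′ t∈ (∈-map⁺ class (∈-allFin i))

  restAt⊆local : ∀ {b k t} → t ∈ restAt b k → t ∈ local b
  restAt⊆local {b} t∈ with ∈-map⁻ (map (embed b)) t∈
  ... | s , s∈ , refl = ∈-map⁺ (map (embed b)) (rest9⊆triples9 s∈)

  rest-local : ∀ {t} (r : RestTriple t) → t ∈ local (block r)
  rest-local r = restAt⊆local {block r} (∈restAt r)

  rest-∞∉ : ∀ {t} → RestTriple t → ∞ ∉ t
  rest-∞∉ (rest b _ k t∈) with ∈-map⁻ (map (embed b)) t∈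
  ... | s , s∈ , refl = ∞∉-lift (∞∉rest9 s∈)

  rest-points : ∀ {t x} (r : RestTriple t) → x ∈ t → x ∈ Pts9 (block r)
  rest-points r = local-points (block∈B r) (rest-local r)

  rest-over : ∀ {t x} → RestTriple t → x ∈ t → ∃[ u ] Over u x
  rest-over {x = x} r x∈t with ∞-or-Over x
  ... | inj₁ refl = ⊥-elim (rest-∞∉ r x∈t)
  ... | inj₂ over = over

  -- Otherwise t would share the pair x, y with the spoke of u, another line of the local system.
  rest-fibre-once : ∀ {t x y u} (r : RestTriple t) → x ≢ y → Over u x → Over u y → x ∈ t → y ∈ t → ⊥
  rest-fibre-once r x≢y ox oy x∈t y∈t = rest-∞∉ r (subst (∞ ∈_) (sym t≡spoke) (here refl))
    where
    t≡spoke = IsDesign.pair-unique (local-design (block∈B r)) x≢y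
      (rest-local r) (spoke∈local (block∈B r) (∈Pts9⇒Over ox (rest-points r x∈t)))
      x∈t y∈t (Over⇒∈spoke ox) (Over⇒∈spoke oy)

  rest-pair-block : ∀ {t t′ x y} (r : RestTriple t) (r′ : RestTriple t′) → x ≢ y →
                    x ∈ t → y ∈ t → x ∈ t′ → y ∈ t′ → block r ≡ block r′
  rest-pair-block r r′ x≢y x∈t y∈t x∈t′ y∈t′ with rest-over r x∈t | rest-over r y∈t
  ... | u , ox | w , oy with u Fin.≟ w
  ...   | yes refl = ⊥-elim (rest-fibre-once r x≢y ox oy x∈t y∈t)
  ...   | no u≢w   = pair-unique u≢w (block∈B r) (block∈B r′)
    (∈Pts9⇒Over ox (rest-points r x∈t))  (∈Pts9⇒Over oy (rest-points r y∈t))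
    (∈Pts9⇒Over ox (rest-points r′ x∈t′)) (∈Pts9⇒Over oy (rest-points r′ y∈t′))

  rest-two-distinct : ∀ {t} → RestTriple t → ∃₂ λ x y → x ≢ y × x ∈ t × y ∈ t
  rest-two-distinct r = two-distinct (IsDesign.block-no-repeat D (rest-local r)) (IsDesign.block-size D (rest-local r))
    where D = local-design (block∈B r)

  rest-block-unique : ∀ {t} (r r′ : RestTriple t) → block r ≡ block r′
  rest-block-unique r r′ with rest-two-distinct r
  ... | x , y , x≢y , x∈t , y∈t = rest-pair-block r r′ x≢y x∈t y∈t x∈t y∈t

  restAt-index-unique : ∀ {b k k′ t} → b ∈ B → t ∈ restAt b k → t ∈ restAt b k′ → k ≡ k′
  restAt-index-unique {b} b∈B t∈ t∈′ with ∈-map⁻ (map (embed b)) t∈ | ∈-map⁻ (map (embed b)) t∈′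
  ... | s , s∈ , refl | s′ , s′∈ , eq =
    rest9-disjoint s∈ (subst (_∈ _) (sym (map-injective (embed-injective b∈B) eq)) s′∈)

  rest-owner-unique : ∀ {t} (r r′ : RestTriple t) → owner r ≡ owner r′
  rest-owner-unique r@(rest b b∈B k t∈) r′@(rest _ _ k′ t∈′) with rest-block-unique r r′
  ... | refl = cong (corner b) (restAt-index-unique b∈B t∈ t∈′)

  -- t and the spoke of its owner are lines of the same local parallel class.
  rest-apart-from-spoke : ∀ {t x} (r : RestTriple t) → x ∈ t → x ∉ spoke (owner r)
  rest-apart-from-spoke r@(rest b b∈B k t∈) x∈t x∈spoke = rest-∞∉ r (subst (∞ ∈_) spoke≡t (here refl))
    where spoke≡t = ParallelClass.disjoint (local-class b∈B k) (here refl) (there t∈) x∈spoke x∈t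

  class-unique : ∀ i → Unique (class i)
  class-unique i = All.tabulate spoke-not-rest AllPairs.∷
    Unique-concatMap⁺ (λ b → classPart b i) blocks-distinct part-unique parts-separated
    where
    spoke-not-rest : ∀ {t} → t ∈ classTail i → spoke i ≢ t
    spoke-not-rest t∈ refl = rest-∞∉ (proj₁ (∈classTail⁻ t∈)) (here refl)
    part-unique : ∀ {b} → b ∈ B → Unique (classPart b i)
    part-unique {b} b∈B = Unique-concatMap⁺ (restAt b) (Unique.filter⁺ (corner-at? b i) (Unique.allFin⁺ 4))
      (λ {k} _ → Unique.map⁺ (map-injective (embed-injective b∈B)) (rest9-unique k))
      (λ _ _ → restAt-index-unique b∈B)
    parts-separated : ∀ {b b′ t} → b ∈ B → b′ ∈ B → t ∈ classPart b i → t ∈ classPart b′ i → b ≡ b′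
    parts-separated {b} {b′} b∈B b′∈B t∈ t∈′ with ∈classPart⁻ b t∈ | ∈classPart⁻ b′ t∈′
    ... | k , _ , t∈restAt | k′ , _ , t∈restAt′ = rest-block-unique (rest b b∈B k t∈restAt) (rest b′ b′∈B k′ t∈restAt′)

  class-determined : ∀ {i j t} → t ∈ class i → t ∈ class j → i ≡ j
  class-determined t∈i t∈j with ∈class⁻ t∈i | ∈class⁻ t∈j
  ... | inj₁ refl     | inj₁ t≡spoke  = spoke-injective t≡spoke
  ... | inj₁ refl     | inj₂ (r′ , _) = ⊥-elim (rest-∞∉ r′ (here refl))
  ... | inj₂ (r , _)  | inj₁ refl     = ⊥-elim (rest-∞∉ r (here refl))
  ... | inj₂ (r , refl) | inj₂ (r′ , refl) = rest-owner-unique r r′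

  T-unique : Unique T
  T-unique = Unique.concat⁺ (All.map⁺ (All.tabulate⁺ {f = id} class-unique))
    (AllPairs.map⁺ (AllPairs.map (λ i≢j {t} t∈both → i≢j (class-determined (proj₁ t∈both) (proj₂ t∈both)))
                                 (Unique.allFin⁺ (2 + n))))

  class-covers-over : ∀ i {u x} → Over u x → ∃[ t ] (t ∈ class i × x ∈ t)
  class-covers-over i {u} ox with u Fin.≟ i
  ... | yes refl = spoke i , here refl , Over⇒∈spoke ox
  ... | no u≢i with pair-covered {u} {i} tt tt u≢i
  ...   | b , b∈B , u∈b , i∈b with ∈⇒corner b∈B i∈b
  ...     | k , refl with ParallelClass.covers (local-class b∈B k) (Over⇒∈Pts9 ox u∈b)
  ...       | _ , here refl , x∈spoke = ⊥-elim (u≢i (Over-unique ox (∈spoke⇒Over x∈spoke (Over-≢∞ ox))))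
  ...       | t , there t∈restAt , x∈t = t , ∈class⁺ (rest b b∈B k t∈restAt) , x∈t

  rest-class-disjoint : ∀ {t t′ x} (r : RestTriple t) (r′ : RestTriple t′) → owner r ≡ owner r′ →
                        x ∈ t → x ∈ t′ → t ≡ t′
  rest-class-disjoint r@(rest b b∈B k t∈restAt) r′@(rest b′ b′∈B k′ t′∈restAt) owner≡ x∈t x∈t′
    with rest-over r x∈t
  ... | u , ox with u Fin.≟ corner b k
  ...   | yes refl = ⊥-elim (rest-apart-from-spoke r x∈t (Over⇒∈spoke ox))
  ...   | no u≢i with pair-unique u≢i b∈B b′∈B
                        (∈Pts9⇒Over ox (rest-points r x∈t))  (corner∈ b∈B k)
                        (∈Pts9⇒Over ox (rest-points r′ x∈t′)) (subst (_∈ b′) (sym owner≡) (corner∈ b′∈B k′))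
  ...     | refl with corner-injective b∈B owner≡
  ...       | refl = ParallelClass.disjoint (local-class b∈B k) (there t∈restAt) (there t′∈restAt) x∈t x∈t′

  class-parallel : ∀ i → ParallelClass (λ _ → ⊤) (class i)
  class-parallel i = record { covers = λ {x} _ → covers x ; disjoint = disjoint }
    where
    covers : ∀ x → ∃[ t ] (t ∈ class i × x ∈ t)
    covers x with ∞-or-Over x
    ... | inj₁ refl      = spoke i , here refl , here refl
    ... | inj₂ (_ , ox)  = class-covers-over i ox
    disjoint : ∀ {x t t′} → t ∈ class i → t′ ∈ class i → x ∈ t → x ∈ t′ → t ≡ t′
    disjoint {x} t∈ t′∈ x∈t x∈t′ with ∈class⁻ t∈ | ∈class⁻ t′∈
    ... | inj₁ refl        | inj₁ refl         = refl
    ... | inj₁ refl        | inj₂ (r′ , refl)  = ⊥-elim (rest-apart-from-spoke r′ x∈t′ x∈t)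
    ... | inj₂ (r , refl)  | inj₁ refl         = ⊥-elim (rest-apart-from-spoke r x∈t x∈t′)
    ... | inj₂ (r , refl)  | inj₂ (r′ , owner≡) = rest-class-disjoint r r′ (sym owner≡) x∈t x∈t′

  ∈T-view : ∀ {t} → t ∈ T → (∃[ i ] t ≡ spoke i) ⊎ RestTriple t
  ∈T-view t∈ with ∈T⁻ t∈
  ... | i , t∈class with ∈class⁻ t∈class
  ...   | inj₁ t≡spoke = inj₁ (i , t≡spoke)
  ...   | inj₂ (r , _) = inj₂ r

  local⊆T : ∀ {b t} → b ∈ B → t ∈ local b → t ∈ T
  local⊆T {b} b∈B t∈ with ∈-map⁻ (map (embed b)) t∈
  ... | s , s∈ , refl with ∈triples9⁻ s∈
  ...   | k , inj₁ refl   = ∈T⁺ {corner b k} (here refl)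
  ...   | k , inj₂ s∈rest = ∈T⁺ (∈class⁺ (rest b b∈B k (∈-map⁺ (map (embed b)) s∈rest)))

  blocks-through : ∀ u w → ∃[ b ] (b ∈ B × u ∈ b × w ∈ b)
  blocks-through u w with u Fin.≟ w
  ... | yes refl = let b , b∈B , u∈b = in-some-block u in b , b∈B , u∈b , u∈b
  ... | no u≢w   = pair-covered tt tt u≢w

  pair-in-some-block : ∀ x y → ∃[ b ] (b ∈ B × x ∈ Pts9 b × y ∈ Pts9 b)
  pair-in-some-block x y with ∞-or-Over x | ∞-or-Over y
  ... | inj₁ refl | inj₁ refl =
    let b , b∈B , _ = in-some-block zero in b , b∈B , here refl , here refl
  ... | inj₁ refl | inj₂ (w , oy) =
    let b , b∈B , w∈b = in-some-block w in b , b∈B , here refl , Over⇒∈Pts9 oy w∈b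
  ... | inj₂ (u , ox) | inj₁ refl =
    let b , b∈B , u∈b = in-some-block u in b , b∈B , Over⇒∈Pts9 ox u∈b , here refl
  ... | inj₂ (u , ox) | inj₂ (w , oy) =
    let b , b∈B , u∈b , w∈b = blocks-through u w in b , b∈B , Over⇒∈Pts9 ox u∈b , Over⇒∈Pts9 oy w∈b

  spoke-rest-share-one : ∀ {i t x y} → RestTriple t → x ≢ y → x ∈ spoke i → y ∈ spoke i → x ∈ t → y ∈ t → ⊥
  spoke-rest-share-one r x≢y x∈spoke y∈spoke x∈t y∈t = rest-fibre-once r x≢y
    (∈spoke⇒Over x∈spoke λ { refl → rest-∞∉ r x∈t }) (∈spoke⇒Over y∈spoke λ { refl → rest-∞∉ r y∈t }) x∈t y∈t

  T-pair-covered : ∀ {x y} → x ≢ y → ∃[ t ] (t ∈ T × x ∈ t × y ∈ t)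
  T-pair-covered {x} {y} x≢y with pair-in-some-block x y
  ... | b , b∈B , x∈b , y∈b with IsDesign.pair-covered (local-design b∈B) x∈b y∈b x≢y
  ...   | t , t∈ , x∈t , y∈t = t , local⊆T b∈B t∈ , x∈t , y∈t

  T-pair-unique : ∀ {x y t t′} → x ≢ y → t ∈ T → t′ ∈ T → x ∈ t → y ∈ t → x ∈ t′ → y ∈ t′ → t ≡ t′
  T-pair-unique {x} {y} x≢y t∈ t′∈ x∈t y∈t x∈t′ y∈t′ with ∈T-view t∈ | ∈T-view t′∈
  ... | inj₁ (i , refl) | inj₁ (j , refl) = cong spoke (spoke-pair-unique x≢y x∈t y∈t x∈t′ y∈t′)
  ... | inj₁ (i , refl) | inj₂ r′         = ⊥-elim (spoke-rest-share-one r′ x≢y x∈t y∈t x∈t′ y∈t′)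
  ... | inj₂ r          | inj₁ (j , refl) = ⊥-elim (spoke-rest-share-one r x≢y x∈t′ y∈t′ x∈t y∈t)
  ... | inj₂ r          | inj₂ r′         = IsDesign.pair-unique (local-design (block∈B r)) x≢y (rest-local r)
    (subst (λ b → _ ∈ local b) (sym (rest-pair-block r r′ x≢y x∈t y∈t x∈t′ y∈t′)) (rest-local r′))
    x∈t y∈t x∈t′ y∈t′

  T-design : IsDesign 3 (λ _ → ⊤) T
  T-design = record
    { blocks-distinct = T-unique
    ; block-size      = size
    ; block-no-repeat = no-repeat
    ; block-points    = λ _ → All.tabulate (λ _ → tt)
    ; pair-covered    = λ _ _ → T-pair-covered
    ; pair-unique     = T-pair-unique
    }
    where
    size : ∀ {t} → t ∈ T → length t ≡ 3
    size t∈ with ∈T-view t∈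
    ... | inj₁ (_ , refl) = refl
    ... | inj₂ r          = IsDesign.block-size (local-design (block∈B r)) (rest-local r)
    no-repeat : ∀ {t} → t ∈ T → Unique t
    no-repeat t∈ with ∈T-view t∈
    ... | inj₁ (_ , refl) = spoke-unique
    ... | inj₂ r          = IsDesign.block-no-repeat (local-design (block∈B r)) (rest-local r)

  T-kts : IsKTS (λ _ → ⊤) T
  T-kts = T-design , resolution , ↭-reflexive refl , All.map⁺ (All.tabulate⁺ {f = id} class-parallel)

  T-isKQ : IsKQ B T
  T-isKQ = record
    { kts       = T-kts
    ; local     = λ {b} _ → local b
    ; local-kts = local-kts
    ; local-∞   = λ b∈B w∈b → spoke _ , spoke∈local b∈B w∈b , here refl , there (here refl) , there (there (here refl))
    ; T⊆union   = T⊆union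
    ; union⊆T   = λ {b} b∈B {t} t∈ → t , local⊆T b∈B t∈ , SameSet-refl t
    }
    where
    T⊆union : ∀ {t} → t ∈ T → ∃[ b ] Σ (b ∈ B) λ _ → ∃[ t′ ] (t′ ∈ local b × SameSet t t′)
    T⊆union {t} t∈ with ∈T-view t∈
    ... | inj₁ (i , refl) = let b , b∈B , i∈b = in-some-block i in b , b∈B , t , spoke∈local b∈B i∈b , SameSet-refl t
    ... | inj₂ r          = block r , block∈B r , t , rest-local r , SameSet-refl t

  module _ {δ} (c : Fin (2 + n) → Fin δ) (three-colours : ∀ {b} → b ∈ B → AtLeast3Colours c b) where

    rest-not-monochromatic : ∀ {t} → RestTriple t → ¬ Monochromatic (extend-colouring c) t
    rest-not-monochromatic (rest b b∈B k t∈) mono with ∈-map⁻ (map (embed b)) t∈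
    ... | s , s∈ , refl with three-colours b∈B
    ...   | x , y , z , x∈b , y∈b , z∈b , cxy , cyz , cxz
          with ∈⇒corner b∈B x∈b | ∈⇒corner b∈B y∈b | ∈⇒corner b∈B z∈b
    ...     | _ , refl | _ , refl | _ , refl
            with meets-two-colours {g = c ∘ corner b} (rest9-misses-at-most-one s∈) cxy cyz cxz
    ...       | _ , _ , meets-i , meets-j , ci≢cj =
                ci≢cj (monochromatic-fibres c mono (Meets-lift meets-i) (Meets-lift meets-j))

    T-not-monochromatic : ∀ {t} → t ∈ T → ¬ Monochromatic (extend-colouring c) t
    T-not-monochromatic t∈ with ∈T-view t∈
    ... | inj₁ (_ , refl) = spoke-not-monochromatic c
    ... | inj₂ r          = rest-not-monochromatic r

theorem6p5 : (v δ : ℕ) → 2 ≤ v → (B : List (List (Fin v))) → QuadrupleSystem v B →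
             (c : Fin v → Fin δ) → (∀ {b} → b ∈ B → AtLeast3Colours c b) →
             ∃[ T ] (IsKQ B T × Colourable (suc δ) T)
theorem6p5 (suc (suc n)) δ (s≤s (s≤s _)) B QS c three-colours =
  T , T-isKQ , extend-colouring c , T-not-monochromatic c three-colours
  where open Construction B QS
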